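{- For every positive integer $n$, $C_{U(n)}(n)=2^{\Omega(n)}$.
   Context: $\mathbb{Z}_n=\mathbb{Z}/n\mathbb{Z}$ and $U(n)$ is its group of units. If $n=p_1^{r_1}\cdots p_s^{r_s}$ with distinct primes $p_i$, then $\Omega(n)=r_1+\cdots+r_s$. For $A\subseteq \mathbb{Z}_n$ and a sequence $S=(x_1,\ldots,x_k)$ in $\mathbb{Z}_n$, an $A$-weighted zero-sum subsequence of consecutive terms is given by a non-empty set $I\subseteq[1,k]$ of consecutive integers together with elements $a_i\in A$ ($i\in I$) such that $\sum_{i\in I}a_ix_i=0$. $C_A(n)$ is the least positive integer $k$ such that every sequence of length $k$ in $\mathbb{Z}_n$ has an $A$-weighted zero-sum subsequence of consecutive terms. -}

module Defs where

open import Data.Nat using (ℕ; zero; suc; _+_; _*_; _≤_; _<_)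
open import Data.Nat.Divisibility using (_∣_)
open import Data.Nat.Coprimality using (Coprime)
open import Data.Nat.Primality using (Prime)
open import Data.Fin using (Fin; toℕ) renaming (zero to fzero; suc to fsuc)
open import Data.List using (List)
open import Data.Nat.ListAction using (product)
open import Data.List.Relation.Unary.All using (All)
open import Data.Product using (Σ; ∃; _×_)
open import Relation.Nullary using (¬_)
open import Relation.Binary.PropositionalEquality using (_≡_)

-- ℤ_n is represented by Fin n (residues 0,…,n-1); a congruence class is zero
-- iff n divides its representative.  The unit group U(n) is the set of
-- residues a with gcd(a,n) = 1.
Unit : (n : ℕ) → Fin n → Set
Unit n a = Coprime (toℕ a) n

sumFromTo : ℕ → ℕ → (ℕ → ℕ) → ℕ
sumFromTo i zero    f = 0
sumFromTo i (suc m) f = f i + sumFromTo (suc i) m f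

-- Extend a sequence x : Fin k → Fin n to ℕ (value 0 outside range; only
-- used on indices in range).
at : ∀ {k n} → (Fin k → Fin n) → ℕ → ℕ
at {zero}  x t       = 0
at {suc k} x zero    = toℕ (x fzero)
at {suc k} x (suc t) = at (λ i → x (fsuc i)) t

HasUnitWeightedConsecutiveZeroSum : (n k : ℕ) → (Fin k → Fin n) → Set
HasUnitWeightedConsecutiveZeroSum n k x =
  Σ ℕ λ i → Σ ℕ λ m → 1 ≤ m × i + m ≤ k ×
  Σ (ℕ → Fin n) λ a → (∀ t → Unit n (a t)) ×
  n ∣ sumFromTo i m (λ t → toℕ (a t) * at x t)

IsCUn : (n c : ℕ) → Set
IsCUn n c =
  1 ≤ c ×
  (∀ (x : Fin c → Fin n) → HasUnitWeightedConsecutiveZeroSum n c x) ×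
  (∀ k → 1 ≤ k → k < c →
     ∃ λ (x : Fin k → Fin n) → ¬ HasUnitWeightedConsecutiveZeroSum n k x)

-- ps is a prime factorisation of n (with multiplicity); then Ω(n) = length ps.
IsPrimeFactorisation : ℕ → List ℕ → Set
IsPrimeFactorisation n ps = All Prime ps × product ps ≡ n

-- Lower bound: for ps = p ∷ qs put w_ps = p·w_qs , 1 , p·w_qs, a sequence of length
-- 2^Ω - 1 (with w_[] empty).  A segment inside one half is p times a segment of
-- w_qs, so by induction it has no zero sum modulo n / p; a segment through the
-- centre has every term but the 1 divisible by p, so modulo p its weighted sum is
-- the centre weight, a unit.
--
-- Upper bound: call a segment balanced if, for every prime power q^(v+1) dividing n,
-- an even number of its terms have q-adic valuation exactly v.  The prefix parities
-- of these Ω counts take at most 2^Ω values on the 2^Ω + 1 prefixes, so some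
-- segment is balanced.  A balanced segment has a unit-weighted zero sum, by
-- induction on n = p m.  If p ∤ m, combine by the Chinese remainder theorem a
-- zero sum modulo m with one modulo p, obtained by pairing up the terms prime to p
-- (there is an even number of them).  If p ∣ m and p divides every term, divide by
-- p, which shifts the valuations down by one.  Otherwise a zero sum modulo m is
-- corrected to one modulo p m by changing the weight of a term prime to p by a
-- multiple of m.

module Submission where

open import Defs
open import Data.Nat using (ℕ; _^_; _≤_)
open import Data.List using (List; length)

open import Data.Bool using (Bool; true; false; _xor_)
open import Data.Bool.Properties using (xor-assoc; xor-same)
open import Data.Empty using (⊥; ⊥-elim)
open import Data.Fin using (Fin; toℕ; fromℕ<; funToFin; finToFun)
import Data.Fin as Fin
open import Data.Fin.Properties using (2↔Bool; finToFun-funToFin; pigeonhole; toℕ<n; toℕ-fromℕ<)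
open import Data.List using ([]; _∷_; map; lookup)
open import Data.List.Properties using (length-map)
open import Data.List.Membership.Propositional using (_∈_)
open import Data.List.Membership.Propositional.Properties using (∈-map⁺)
open import Data.List.Relation.Unary.All using (All; _∷_)
open import Data.List.Relation.Unary.Any using (here; there; index)
open import Data.List.Relation.Unary.Any.Properties using (lookup-index)
open import Data.Nat using (zero; suc; _+_; _*_; _∸_; _<_; z≤n; s≤s; s≤s⁻¹; NonZero; pred)
open import Data.Nat.Base using (nonTrivial⇒≢1; nonTrivial⇒n>1)
open import Data.Nat.Coprimality using (Coprime; coprime-divisor; coprime-Bézout; 1-coprimeTo)
import Data.Nat.Coprimality as Coprimality
open import Data.Nat.DivMod
open import Data.Nat.Divisibility
open import Data.Nat.GCD using (module Bézout)
open import Data.Nat.ListAction using (product)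
open import Data.Nat.Primality
  using (Prime; euclidsLemma; prime⇒nonTrivial; prime⇒irreducible; prime⇒nonZero; productOfPrimes≢0)
open import Data.Nat.Properties
open import Data.Nat.Solver using (module +-*-Solver)
open +-*-Solver using (solve; _:*_; _:+_; con; _:=_)
open import Data.Product using (Σ; _×_; _,_; proj₁; proj₂; uncurry)
open import Data.Sum using (_⊎_; inj₁; inj₂)
open import Function.Bundles using (_⇔_; mk⇔; Equivalence; Inverse)
open import Relation.Binary.Definitions using (tri<; tri≈; tri>)
open import Relation.Binary.PropositionalEquality
open import Relation.Nullary using (¬_; Dec; yes; no; does; ¬?)
open import Relation.Nullary.Decidable using (_×-dec_; does-⇔)

OnRange : ℕ → ℕ → (ℕ → Set) → Set
OnRange i l P = ∀ t → i ≤ t → t < i + l → P t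

onRange-head : ∀ {i l P} → OnRange i (suc l) P → P i
onRange-head {i} h = h i ≤-refl (m<m+n i (s≤s z≤n))

onRange-tail : ∀ {i l P} → OnRange i (suc l) P → OnRange (suc i) l P
onRange-tail {i} {l} h t i<t t<i+l = h t (<⇒≤ i<t) (subst (t <_) (sym (+-suc i l)) t<i+l)

onRange-cons : ∀ {i l P} → P i → OnRange (suc i) l P → OnRange i (suc l) P
onRange-cons {i} {l} hi h t i≤t t<i+l with m≤n⇒m<n∨m≡n i≤t
... | inj₁ i<t  = h t i<t (subst (t <_) (+-suc i l) t<i+l)
... | inj₂ refl = hi

onRange-empty : ∀ {i t} → i ≤ t → ¬ t < i + 0
onRange-empty {i} i≤t t<i = <-irrefl refl (≤-trans t<i (subst (_≤ _) (sym (+-identityʳ i)) i≤t))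

onRange-or-counterexample : ∀ {P : ℕ → Set} → (∀ t → Dec (P t)) → ∀ i l →
                            OnRange i l P ⊎ Σ ℕ λ s → i ≤ s × s < i + l × ¬ P s
onRange-or-counterexample P? i zero = inj₁ λ t i≤t t<i → ⊥-elim (onRange-empty i≤t t<i)
onRange-or-counterexample P? i (suc l) with P? i | onRange-or-counterexample P? (suc i) l
... | no ¬Pi | _  = inj₂ (i , ≤-refl , m<m+n i (s≤s z≤n) , ¬Pi)
... | yes Pi | inj₁ all = inj₁ (onRange-cons Pi all)
... | yes Pi | inj₂ (s , i<s , s<i+1+l , ¬Ps) = inj₂ (s , <⇒≤ i<s , subst (s <_) (sym (+-suc i l)) s<i+1+l , ¬Ps)

sumFromTo-cong : ∀ i l {f g : ℕ → ℕ} → OnRange i l (λ t → f t ≡ g t) →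
                 sumFromTo i l f ≡ sumFromTo i l g
sumFromTo-cong i zero    h = refl
sumFromTo-cong i (suc l) h = cong₂ _+_ (onRange-head h) (sumFromTo-cong (suc i) l (onRange-tail h))

sumFromTo-* : ∀ i l k (f : ℕ → ℕ) → sumFromTo i l (λ t → k * f t) ≡ k * sumFromTo i l f
sumFromTo-* i zero    k f = sym (*-zeroʳ k)
sumFromTo-* i (suc l) k f =
  trans (cong (k * f i +_) (sumFromTo-* (suc i) l k f)) (sym (*-distribˡ-+ k (f i) _))

sumFromTo-shift : ∀ d j l (f : ℕ → ℕ) → sumFromTo (d + j) l f ≡ sumFromTo j l (λ t → f (d + t))
sumFromTo-shift d j zero    f = refl
sumFromTo-shift d j (suc l) f = cong (f (d + j) +_)
  (trans (cong (λ k → sumFromTo k l f) (sym (+-suc d j))) (sumFromTo-shift d (suc j) l f))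

sumFromTo-% : ∀ i l n .{{_ : NonZero n}} {f g : ℕ → ℕ} → (∀ t → f t % n ≡ g t % n) →
              sumFromTo i l f % n ≡ sumFromTo i l g % n
sumFromTo-% i zero    n h = refl
sumFromTo-% i (suc l) n {f} {g} h = begin
  (f i + sumFromTo (suc i) l f) % n                 ≡⟨ %-distribˡ-+ (f i) _ n ⟩
  (f i % n + sumFromTo (suc i) l f % n) % n         ≡⟨ cong₂ (λ a b → (a + b) % n) (h i) (sumFromTo-% (suc i) l n h) ⟩
  (g i % n + sumFromTo (suc i) l g % n) % n         ≡⟨ %-distribˡ-+ (g i) _ n ⟨
  (g i + sumFromTo (suc i) l g) % n                 ∎
  where open ≡-Reasoning

∣-sumFromTo : ∀ i l {d} {f : ℕ → ℕ} → OnRange i l (λ t → d ∣ f t) → d ∣ sumFromTo i l f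
∣-sumFromTo i zero    h = _ ∣0
∣-sumFromTo i (suc l) h = ∣m∣n⇒∣m+n (onRange-head h) (∣-sumFromTo (suc i) l (onRange-tail h))

sumFromTo-exchange : ∀ i l s (f g : ℕ → ℕ) → i ≤ s → s < i + l → (∀ t → t ≢ s → f t ≡ g t) →
                     sumFromTo i l f + g s ≡ sumFromTo i l g + f s
sumFromTo-exchange i zero    s f g i≤s s<i h = ⊥-elim (onRange-empty i≤s s<i)
sumFromTo-exchange i (suc l) s f g i≤s s<i h with m≤n⇒m<n∨m≡n i≤s
... | inj₂ refl = begin
  f i + F + g i ≡⟨ cong (λ z → f i + z + g i) (sumFromTo-cong (suc i) l (λ t i<t _ → h t (>⇒≢ i<t))) ⟩
  f i + G + g i ≡⟨ solve 3 (λ a b c → a :+ b :+ c := c :+ b :+ a) refl (f i) G (g i) ⟩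
  g i + G + f i ∎
  where open ≡-Reasoning
        F G : ℕ
        F = sumFromTo (suc i) l f
        G = sumFromTo (suc i) l g
... | inj₁ i<s = begin
  f i + F + g s   ≡⟨ +-assoc (f i) F (g s) ⟩
  f i + (F + g s) ≡⟨ cong₂ _+_ (h i (<⇒≢ i<s)) (sumFromTo-exchange (suc i) l s f g i<s (subst (s <_) (+-suc i l) s<i) h) ⟩
  g i + (G + f s) ≡⟨ +-assoc (g i) G (f s) ⟨
  g i + G + f s   ∎
  where open ≡-Reasoning
        F G : ℕ
        F = sumFromTo (suc i) l f
        G = sumFromTo (suc i) l g

%-cong-+ˡ : ∀ w {x y} n .{{_ : NonZero n}} → x % n ≡ y % n → (w + x) % n ≡ (w + y) % n
%-cong-+ˡ w {x} {y} n e = begin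
  (w + x) % n             ≡⟨ %-distribˡ-+ w x n ⟩
  (w % n + x % n) % n     ≡⟨ cong (λ v → (w % n + v) % n) e ⟩
  (w % n + y % n) % n     ≡⟨ %-distribˡ-+ w y n ⟨
  (w + y) % n             ∎
  where open ≡-Reasoning

%-cong-*ʳ : ∀ z {x y} n .{{_ : NonZero n}} → x % n ≡ y % n → (x * z) % n ≡ (y * z) % n
%-cong-*ʳ z {x} {y} n e = begin
  (x * z) % n             ≡⟨ %-distribˡ-* x z n ⟩
  (x % n * (z % n)) % n   ≡⟨ cong (λ v → (v * (z % n)) % n) e ⟩
  (y % n * (z % n)) % n   ≡⟨ %-distribˡ-* y z n ⟨
  (y * z) % n             ∎
  where open ≡-Reasoning

∣-%-cong : ∀ {x y} n .{{_ : NonZero n}} → x % n ≡ y % n → n ∣ y → n ∣ x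
∣-%-cong {x} {y} n e n∣y = m%n≡0⇒n∣m x n (trans e (n∣m⇒m%n≡0 y n n∣y))

%-inverse : ∀ {a n} .{{_ : NonZero n}} → Coprime a n → Σ ℕ λ u → (u * a) % n ≡ 1 % n
%-inverse {a} {n@(suc n-1)} c with coprime-Bézout c
... | Bézout.+- x y 1+yn≡xa = x , (begin
  (x * a) % n        ≡⟨ cong (_% n) 1+yn≡xa ⟨
  (1 + y * n) % n    ≡⟨ [m+kn]%n≡m%n 1 y n ⟩
  1 % n              ∎)
  where open ≡-Reasoning
... | Bézout.-+ x y 1+xa≡yn = n-1 * x , (begin
  (n-1 * x * a) % n                  ≡⟨ [m+kn]%n≡m%n (n-1 * x * a) 1 n ⟨
  (n-1 * x * a + 1 * n) % n          ≡⟨ cong (_% n) (solve 3 (λ k x a → k :* x :* a :+ con 1 :* (con 1 :+ k)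
                                                              := k :* (con 1 :+ x :* a) :+ con 1) refl n-1 x a) ⟩
  (n-1 * (1 + x * a) + 1) % n        ≡⟨ cong (λ z → (n-1 * z + 1) % n) 1+xa≡yn ⟩
  (n-1 * (y * n) + 1) % n            ≡⟨ cong (_% n) (solve 3 (λ k y n → k :* (y :* n) :+ con 1
                                                              := con 1 :+ k :* y :* n) refl n-1 y n) ⟩
  (1 + n-1 * y * n) % n              ≡⟨ [m+kn]%n≡m%n 1 (n-1 * y) n ⟩
  1 % n                              ∎)
  where open ≡-Reasoning

coprime-%-cong : ∀ {a c n} .{{_ : NonZero n}} → a % n ≡ c % n → Coprime c n → Coprime a n
coprime-%-cong e c (d∣a , d∣n) = c (∣n∣m%n⇒∣m d∣n (subst (_ ∣_) e (%-presˡ-∣ d∣a d∣n)) , d∣n)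

coprime-+-* : ∀ {a m} k → Coprime a m → Coprime (a + k * m) m
coprime-+-* {a} {m} k c {d} (d∣a+km , d∣m) =
  c (∣m+n∣m⇒∣n (subst (d ∣_) (+-comm a (k * m)) d∣a+km) (∣n⇒∣m*n k d∣m) , d∣m)

coprime-suc : ∀ k → Coprime k (suc k)
coprime-suc k {d} (d∣k , d∣k+1) = ∣1⇒≡1 (∣m+n∣m⇒∣n (subst (d ∣_) (+-comm 1 k) d∣k+1) d∣k)

coprime-∣ʳ : ∀ {a n d} → Coprime a n → d ∣ n → Coprime a d
coprime-∣ʳ c d∣n (e∣a , e∣d) = c (e∣a , ∣-trans e∣d d∣n)

coprime-*ʳ : ∀ {a p m} → Coprime a p → Coprime a m → Coprime a (p * m)
coprime-*ʳ {a} {p} cp cm {d} (d∣a , d∣pm) = cm (d∣a , coprime-divisor d⊥p d∣pm)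
  where
    d⊥p : Coprime d p
    d⊥p (e∣d , e∣p) = cp (∣-trans e∣d d∣a , e∣p)

coprime-*ʳ-∣ : ∀ {a p m} → p ∣ m → Coprime a m → Coprime a (p * m)
coprime-*ʳ-∣ p∣m c = coprime-*ʳ (coprime-∣ʳ c p∣m) c

coprime-∣-lcm : ∀ {p m x} → Coprime p m → p ∣ x → m ∣ x → p * m ∣ x
coprime-∣-lcm {p} {m} c p∣x (divides k refl) with coprime-divisor c (subst (p ∣_) (*-comm k m) p∣x)
... | divides j refl = divides j (*-assoc j p m)

prime≢1 : ∀ {p} → Prime p → p ≢ 1
prime≢1 pp = nonTrivial⇒≢1 {{prime⇒nonTrivial pp}}

¬∣⇒coprime : ∀ {p a} → Prime p → ¬ p ∣ a → Coprime a p
¬∣⇒coprime pp p∤a (d∣a , d∣p) with prime⇒irreducible pp d∣p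
... | inj₁ d≡1  = d≡1
... | inj₂ refl = ⊥-elim (p∤a d∣a)

coprime⇒¬∣ : ∀ {p a n} → Prime p → Coprime a n → p ∣ n → ¬ p ∣ a
coprime⇒¬∣ pp c p∣n p∣a = prime≢1 pp (c (p∣a , p∣n))

prime∣^⇒∣ : ∀ {p q} k → Prime p → p ∣ q ^ k → p ∣ q
prime∣^⇒∣ zero    pp p∣1 = ⊥-elim (prime≢1 pp (∣1⇒≡1 p∣1))
prime∣^⇒∣ {p} {q} (suc k) pp p∣q^k+1 with euclidsLemma q (q ^ k) pp p∣q^k+1
... | inj₁ p∣q   = p∣q
... | inj₂ p∣q^k = prime∣^⇒∣ k pp p∣q^k

distinctPrimes⇒coprime^ : ∀ {p q} k → Prime p → Prime q → q ≢ p → Coprime (q ^ k) p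
distinctPrimes⇒coprime^ k pp pq q≢p (d∣q^k , d∣p) with prime⇒irreducible pp d∣p
... | inj₁ d≡1  = d≡1
... | inj₂ refl with prime⇒irreducible pq (prime∣^⇒∣ k pp d∣q^k)
...   | inj₁ p≡1 = ⊥-elim (prime≢1 pp p≡1)
...   | inj₂ p≡q = ⊥-elim (q≢p (sym p≡q))

weightedSum : ℕ → ℕ → (ℕ → ℕ) → (ℕ → ℕ) → ℕ
weightedSum i l c y = sumFromTo i l (λ t → c t * y t)

weightedSum-* : ∀ i l b p w → weightedSum i l b (λ t → p * w t) ≡ p * weightedSum i l b w
weightedSum-* i l b p w =
  trans (sumFromTo-cong i l λ t _ _ → solve 3 (λ b p w → b :* (p :* w) := p :* (b :* w)) refl (b t) p (w t))
        (sumFromTo-* i l p (λ t → b t * w t))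

∣-weightedSum-%-cong : ∀ i l n .{{_ : NonZero n}} {a c} y → (∀ t → a t % n ≡ c t % n) →
                       n ∣ weightedSum i l c y → n ∣ weightedSum i l a y
∣-weightedSum-%-cong i l n y a≡c = ∣-%-cong n (sumFromTo-% i l n λ t → %-cong-*ʳ (y t) n (a≡c t))

UnitWeights : ℕ → (ℕ → ℕ) → Set
UnitWeights n c = ∀ t → Coprime (c t) n

UnitZeroSum : ℕ → ℕ → ℕ → (ℕ → ℕ) → Set
UnitZeroSum n i l y = Σ (ℕ → ℕ) λ c → UnitWeights n c × n ∣ weightedSum i l c y

infix 5 _[_]≔_

_[_]≔_ : (ℕ → ℕ) → ℕ → ℕ → ℕ → ℕ
(c [ i ]≔ w) t with t ≟ i
... | yes _ = w
... | no  _ = c t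

[]≔-updates : ∀ c i w → (c [ i ]≔ w) i ≡ w
[]≔-updates c i w with i ≟ i
... | yes _   = refl
... | no  i≢i = ⊥-elim (i≢i refl)

[]≔-minimal : ∀ c i w t → t ≢ i → (c [ i ]≔ w) t ≡ c t
[]≔-minimal c i w t t≢i with t ≟ i
... | yes t≡i = ⊥-elim (t≢i t≡i)
... | no  _   = refl

unitWeights-[]≔ : ∀ {n c} i {w} → UnitWeights n c → Coprime w n → UnitWeights n (c [ i ]≔ w)
unitWeights-[]≔ i cs cw t with t ≟ i
... | yes _ = cw
... | no  _ = cs t

weightedSum-[]≔-head : ∀ i l c w y → weightedSum i (suc l) (c [ i ]≔ w) y ≡ w * y i + weightedSum (suc i) l c y
weightedSum-[]≔-head i l c w y = cong₂ _+_ (cong (_* y i) ([]≔-updates c i w))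
  (sumFromTo-cong (suc i) l λ t i<t _ → cong (_* y t) ([]≔-minimal c i w t (>⇒≢ i<t)))

∣-sumFromTo-single : ∀ i l s {d} {f : ℕ → ℕ} → i ≤ s → s < i + l → (∀ t → t ≢ s → d ∣ f t) →
                     d ∣ sumFromTo i l f → d ∣ f s
∣-sumFromTo-single i l s {d} {f} i≤s s<i+l d∣others d∣S =
  ∣m+n∣m⇒∣n (subst (d ∣_) S≡ (∣m∣n⇒∣m+n d∣S (d ∣0))) (∣-sumFromTo i l λ t _ _ → d∣f₀ t)
  where
    f₀ : ℕ → ℕ
    f₀ = f [ s ]≔ 0
    d∣f₀ : ∀ t → d ∣ f₀ t
    d∣f₀ t with t ≟ s
    ... | yes _   = d ∣0
    ... | no  t≢s = d∣others t t≢s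
    S≡ : sumFromTo i l f + 0 ≡ sumFromTo i l f₀ + f s
    S≡ = trans (cong (sumFromTo i l f +_) (sym ([]≔-updates f s 0)))
               (sumFromTo-exchange i l s f f₀ i≤s s<i+l (λ t t≢s → sym ([]≔-minimal f s 0 t t≢s)))

-- With u m ≡ 1 (mod p), a = b + u (c + (p - 1) b) m is ≡ b (mod m) and
-- ≡ b + c + (p - 1) b ≡ c (mod p).
unitZeroSum-crt : ∀ {p m i l y} .{{_ : NonZero p}} .{{_ : NonZero m}} → Coprime p m →
                  UnitZeroSum p i l y → UnitZeroSum m i l y → UnitZeroSum (p * m) i l y
unitZeroSum-crt {p} {m} {i} {l} {y} p⊥m (c , cs , p∣Sc) (b , bs , m∣Sb) =
  a , (λ t → coprime-*ʳ (coprime-%-cong (a≡c t) (cs t)) (coprime-%-cong (a≡b t) (bs t))) ,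
  coprime-∣-lcm p⊥m (∣-weightedSum-%-cong i l p y a≡c p∣Sc) (∣-weightedSum-%-cong i l m y a≡b m∣Sb)
  where
    u : ℕ
    u = proj₁ (%-inverse (Coprimality.sym p⊥m))
    um≡1 : (u * m) % p ≡ 1 % p
    um≡1 = proj₂ (%-inverse (Coprimality.sym p⊥m))
    q : ℕ
    q = pred p
    correction : ℕ → ℕ
    correction t = u * (c t + q * b t)
    a : ℕ → ℕ
    a t = b t + correction t * m
    a≡b : ∀ t → a t % m ≡ b t % m
    a≡b t = [m+kn]%n≡m%n (b t) (correction t) m
    a≡c : ∀ t → a t % p ≡ c t % p
    a≡c t = begin
      (b t + u * X * m) % p   ≡⟨ cong (λ z → (b t + z) % p) (solve 3 (λ u X m → u :* X :* m := u :* m :* X) refl u X m) ⟩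
      (b t + u * m * X) % p   ≡⟨ %-cong-+ˡ (b t) p (%-cong-*ʳ X p um≡1) ⟩
      (b t + 1 * X) % p       ≡⟨ cong (_% p) (solve 3 (λ b c q → b :+ con 1 :* (c :+ q :* b) := c :+ b :* (con 1 :+ q)) refl (b t) (c t) q) ⟩
      (c t + b t * suc q) % p ≡⟨ cong (λ k → (c t + b t * k) % p) (suc-pred p) ⟩
      (c t + b t * p) % p     ≡⟨ [m+kn]%n≡m%n (c t) (b t) p ⟩
      c t % p                 ∎
      where open ≡-Reasoning
            X : ℕ
            X = c t + q * b t

-- Only the weight at s changes, by a multiple of m chosen to make the quotient
-- (Σ b y) / m divisible by p.
unitZeroSum-refine : ∀ {p m i l y} s .{{_ : NonZero p}} → p ∣ m → i ≤ s → s < i + l → Coprime (y s) p →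
                     UnitZeroSum m i l y → UnitZeroSum (p * m) i l y
unitZeroSum-refine {p} {m} {i} {l} {y} s p∣m i≤s s<i+l ys⊥p (b , bs , divides w Sb≡wm) =
  a , (λ t → coprime-*ʳ-∣ p∣m (unitWeights-[]≔ s bs (coprime-+-* k (bs s)) t)) ,
  subst (p * m ∣_) (sym Sa≡) (subst (_∣ m * (w + k * y s)) (*-comm m p) (*-monoʳ-∣ m p∣w+kys))
  where
    u : ℕ
    u = proj₁ (%-inverse ys⊥p)
    uys≡1 : (u * y s) % p ≡ 1 % p
    uys≡1 = proj₂ (%-inverse ys⊥p)
    k : ℕ
    k = pred p * w * u
    a : ℕ → ℕ
    a = b [ s ]≔ b s + k * m
    Sa≡ : weightedSum i l a y ≡ m * (w + k * y s)
    Sa≡ = +-cancelʳ-≡ (b s * y s) _ _ (begin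
      weightedSum i l a y + b s * y s    ≡⟨ sumFromTo-exchange i l s _ _ i≤s s<i+l (λ t t≢s → cong (_* y t) ([]≔-minimal b s _ t t≢s)) ⟩
      weightedSum i l b y + a s * y s    ≡⟨ cong₂ (λ x z → x + z * y s) Sb≡wm ([]≔-updates b s _) ⟩
      w * m + (b s + k * m) * y s        ≡⟨ solve 5 (λ w m b k v → w :* m :+ (b :+ k :* m) :* v := m :* (w :+ k :* v) :+ b :* v) refl w m (b s) k (y s) ⟩
      m * (w + k * y s) + b s * y s      ∎)
      where open ≡-Reasoning
    p∣w+kys : p ∣ w + k * y s
    p∣w+kys = m%n≡0⇒n∣m _ p (begin
      (w + k * y s) % p                   ≡⟨ cong (λ z → (w + z) % p) (solve 4 (λ q w u v → q :* w :* u :* v := u :* v :* (q :* w)) refl (pred p) w u (y s)) ⟩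
      (w + u * y s * (pred p * w)) % p    ≡⟨ %-cong-+ˡ w p (%-cong-*ʳ (pred p * w) p uys≡1) ⟩
      (w + 1 * (pred p * w)) % p          ≡⟨ cong (_% p) (solve 2 (λ w q → w :+ con 1 :* (q :* w) := w :* (con 1 :+ q)) refl w (pred p)) ⟩
      (w * suc (pred p)) % p              ≡⟨ cong (λ k → (w * k) % p) (suc-pred p) ⟩
      (w * p) % p                         ≡⟨ m*n%n≡0 w p ⟩
      0                                   ∎)
      where open ≡-Reasoning

unitZeroSum-scale : ∀ {p m i l y z} → p ∣ m → OnRange i l (λ t → y t ≡ p * z t) →
                    UnitZeroSum m i l z → UnitZeroSum (p * m) i l y
unitZeroSum-scale {p} {m} {i} {l} {y} {z} p∣m y≡pz (b , bs , m∣Sb) =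
  b , (λ t → coprime-*ʳ-∣ p∣m (bs t)) , subst (p * m ∣_) (sym Sy≡pSz) (*-monoʳ-∣ p m∣Sb)
  where
    Sy≡pSz : weightedSum i l b y ≡ p * weightedSum i l b z
    Sy≡pSz = trans (sumFromTo-cong i l λ t i≤t t<i+l → cong (b t *_) (y≡pz t i≤t t<i+l)) (weightedSum-* i l b p z)

-- Parities of exact valuations

parity : (ℕ → Bool) → ℕ → ℕ → Bool
parity P i zero    = false
parity P i (suc l) = P i xor parity P (suc i) l

parity-cong : ∀ i l {P Q : ℕ → Bool} → OnRange i l (λ t → P t ≡ Q t) → parity P i l ≡ parity Q i l
parity-cong i zero    h = refl
parity-cong i (suc l) h = cong₂ _xor_ (onRange-head h) (parity-cong (suc i) l (onRange-tail h))

parity-++ : ∀ i a b (P : ℕ → Bool) → parity P i (a + b) ≡ parity P i a xor parity P (i + a) b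
parity-++ i zero    b P = cong (λ j → parity P j b) (sym (+-identityʳ i))
parity-++ i (suc a) b P = begin
  P i xor parity P (suc i) (a + b)                         ≡⟨ cong (P i xor_) (parity-++ (suc i) a b P) ⟩
  P i xor (parity P (suc i) a xor parity P (suc i + a) b)  ≡⟨ cong (λ j → P i xor (parity P (suc i) a xor parity P j b)) (sym (+-suc i a)) ⟩
  P i xor (parity P (suc i) a xor parity P (i + suc a) b)  ≡⟨ xor-assoc (P i) _ _ ⟨
  parity P i (suc a) xor parity P (i + suc a) b            ∎
  where open ≡-Reasoning

parity-segment : ∀ P a l → parity P 0 a ≡ parity P 0 (a + l) → parity P a l ≡ false
parity-segment P a l e = begin
  parity P a l                          ≡⟨ cong (_xor parity P a l) (xor-same (parity P 0 a)) ⟨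
  (x xor x) xor parity P a l            ≡⟨ xor-assoc x x (parity P a l) ⟩
  x xor (x xor parity P a l)            ≡⟨ cong (x xor_) (parity-++ 0 a l P) ⟨
  x xor parity P 0 (a + l)              ≡⟨ cong (x xor_) e ⟨
  x xor x                               ≡⟨ xor-same x ⟩
  false                                 ∎
  where open ≡-Reasoning
        x : Bool
        x = parity P 0 a

ExactPower : ℕ → ℕ → ℕ → Set
ExactPower p v y = p ^ v ∣ y × ¬ p ^ suc v ∣ y

exactPower? : ∀ p v y → Dec (ExactPower p v y)
exactPower? p v y = p ^ v ∣? y ×-dec ¬? (p ^ suc v ∣? y)

exactPowerParity : ℕ → ℕ → (ℕ → ℕ) → ℕ → ℕ → Bool
exactPowerParity q v y = parity (λ t → does (exactPower? q v (y t)))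

exactPower₀⇒¬∣ : ∀ {p y} → ExactPower p 0 y → ¬ p ∣ y
exactPower₀⇒¬∣ {p} (_ , ¬p¹∣y) p∣y = ¬p¹∣y (subst (_∣ _) (sym (*-identityʳ p)) p∣y)

¬exactPower₀⇒∣ : ∀ p y → ¬ ExactPower p 0 y → p ∣ y
¬exactPower₀⇒∣ p y ¬e with p ∣? y
... | yes p∣y = p∣y
... | no  p∤y = ⊥-elim (¬e (1∣ y , λ p¹∣y → p∤y (subst (_∣ y) (*-identityʳ p) p¹∣y)))

exactPower-shift : ∀ s q v {y z} → (∀ k → q ^ (s + k) ∣ y ⇔ q ^ k ∣ z) →
                   does (exactPower? q (s + v) y) ≡ does (exactPower? q v z)
exactPower-shift s q v {y} {z} h = does-⇔ (mk⇔ to from) (exactPower? q (s + v) y) (exactPower? q v z)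
  where
    q^[s+1+v]∣y⇔ : q ^ suc (s + v) ∣ y ⇔ q ^ suc v ∣ z
    q^[s+1+v]∣y⇔ = subst (λ e → q ^ e ∣ y ⇔ q ^ suc v ∣ z) (+-suc s v) (h (suc v))
    to : ExactPower q (s + v) y → ExactPower q v z
    to (d , ¬d′) = Equivalence.to (h v) d , λ d′ → ¬d′ (Equivalence.from q^[s+1+v]∣y⇔ d′)
    from : ExactPower q v z → ExactPower q (s + v) y
    from (d , ¬d′) = Equivalence.from (h v) d , λ d′ → ¬d′ (Equivalence.to q^[s+1+v]∣y⇔ d′)

exactPowerParity-shift : ∀ s q v i l {y z} → OnRange i l (λ t → ∀ k → q ^ (s + k) ∣ y t ⇔ q ^ k ∣ z t) →
                         exactPowerParity q (s + v) y i l ≡ exactPowerParity q v z i l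
exactPowerParity-shift s q v i l h = parity-cong i l λ t i≤t t<i+l → exactPower-shift s q v (h t i≤t t<i+l)

Balanced : ℕ → ℕ → ℕ → (ℕ → ℕ) → Set
Balanced n i l y = ∀ q v → Prime q → q ^ suc v ∣ n → exactPowerParity q v y i l ≡ false

balanced-∣ : ∀ {m n i l y} → m ∣ n → Balanced n i l y → Balanced m i l y
balanced-∣ m∣n bal q v pq q^v+1∣m = bal q v pq (∣-trans q^v+1∣m m∣n)

balanced-divide : ∀ {p m i l y z} → Prime p → OnRange i l (λ t → y t ≡ p * z t) →
                  Balanced (p * m) i l y → Balanced m i l z
balanced-divide {p} {m} {i} {l} {y} {z} pp y≡pz bal q v pq q^v+1∣m with q ≟ p
... | yes refl = trans (sym (exactPowerParity-shift 1 p v i l p^[1+k]∣y⇔)) (bal p (suc v) pp (*-monoʳ-∣ p q^v+1∣m))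
  where
    p^[1+k]∣y⇔ : OnRange i l (λ t → ∀ k → p ^ (1 + k) ∣ y t ⇔ p ^ k ∣ z t)
    p^[1+k]∣y⇔ t i≤t t<i+l k rewrite y≡pz t i≤t t<i+l = mk⇔ (*-cancelˡ-∣ p ⦃ prime⇒nonZero pp ⦄) (*-monoʳ-∣ p)
... | no q≢p = trans (sym (exactPowerParity-shift 0 q v i l q^k∣y⇔)) (bal q v pq (∣-trans q^v+1∣m (n∣m*n p)))
  where
    q^k∣y⇔ : OnRange i l (λ t → ∀ k → q ^ k ∣ y t ⇔ q ^ k ∣ z t)
    q^k∣y⇔ t i≤t t<i+l k rewrite y≡pz t i≤t t<i+l =
      mk⇔ (coprime-divisor (distinctPrimes⇒coprime^ k pp pq q≢p)) (∣n⇒∣m*n p)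

-- Balanced segments have zero sums

-- Zero sums modulo a prime p: the terms prime to p are paired up from left to
-- right, a pair (u, y_t) getting the weights (y_t, (p - 1) u) so that it contributes
-- p u y_t; multiples of p get weight 1.  PendingZeroSum i l is the state in which
-- an earlier term u is still unpaired: d is the weight that u will receive.
module PairUp {p} (pp : Prime p) (y : ℕ → ℕ) where

  q : ℕ
  q = pred p

  p≡1+q : p ≡ suc q
  p≡1+q = sym (suc-pred p ⦃ prime⇒nonZero pp ⦄)

  PendingZeroSum : ℕ → ℕ → Set
  PendingZeroSum i l = ∀ u → Coprime u p →
    Σ (ℕ → ℕ) λ c → UnitWeights p c × Σ ℕ λ d → Coprime d p × p ∣ d * u + weightedSum i l c y

  ZeroSumFor : Bool → ℕ → ℕ → Set
  ZeroSumFor false i l = UnitZeroSum p i l y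
  ZeroSumFor true  i l = PendingZeroSum i l

  skipMultiple : ∀ {b i l} → p ∣ y i → ZeroSumFor b (suc i) l → ZeroSumFor b i (suc l)
  skipMultiple {false} {i} {l} p∣yi (c , cs , p∣S) =
    c [ i ]≔ 1 , unitWeights-[]≔ i cs (1-coprimeTo p) ,
    subst (p ∣_) (sym (weightedSum-[]≔-head i l c 1 y)) (∣m∣n⇒∣m+n (∣n⇒∣m*n 1 p∣yi) p∣S)
  skipMultiple {true} {i} {l} p∣yi pending u u⊥p with pending u u⊥p
  ... | c , cs , d , d⊥p , p∣S =
    c [ i ]≔ 1 , unitWeights-[]≔ i cs (1-coprimeTo p) , d , d⊥p ,
    subst (p ∣_) (sym eq) (∣m∣n⇒∣m+n (∣n⇒∣m*n 1 p∣yi) p∣S)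
    where
      eq : d * u + weightedSum i (suc l) (c [ i ]≔ 1) y ≡ 1 * y i + (d * u + weightedSum (suc i) l c y)
      eq = trans (cong (d * u +_) (weightedSum-[]≔-head i l c 1 y))
                 (solve 3 (λ a b s → a :+ (b :+ s) := b :+ (a :+ s)) refl (d * u) (1 * y i) _)

  openPair : ∀ {i l} → Coprime (y i) p → UnitZeroSum p (suc i) l y → PendingZeroSum i (suc l)
  openPair {i} {l} yi⊥p (c , cs , p∣S) u u⊥p =
    c [ i ]≔ q * u , unitWeights-[]≔ i cs qu⊥p , y i , yi⊥p ,
    subst (p ∣_) (sym eq) (∣m∣n⇒∣m+n (m∣m*n (u * y i)) p∣S)
    where
      qu⊥p : Coprime (q * u) p
      qu⊥p = Coprimality.sym (coprime-*ʳ (subst (λ m → Coprime m q) (sym p≡1+q) (Coprimality.sym (coprime-suc q))) (Coprimality.sym u⊥p))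
      eq : y i * u + weightedSum i (suc l) (c [ i ]≔ q * u) y ≡ p * (u * y i) + weightedSum (suc i) l c y
      eq = begin
        y i * u + weightedSum i (suc l) (c [ i ]≔ q * u) y     ≡⟨ cong (y i * u +_) (weightedSum-[]≔-head i l c (q * u) y) ⟩
        y i * u + (q * u * y i + weightedSum (suc i) l c y)   ≡⟨ solve 4 (λ q u v s → v :* u :+ (q :* u :* v :+ s) := (con 1 :+ q) :* (u :* v) :+ s) refl q u (y i) _ ⟩
        suc q * (u * y i) + weightedSum (suc i) l c y         ≡⟨ cong (λ k → k * (u * y i) + _) p≡1+q ⟨
        p * (u * y i) + weightedSum (suc i) l c y             ∎
        where open ≡-Reasoning

  closePair : ∀ {i l} → Coprime (y i) p → PendingZeroSum (suc i) l → UnitZeroSum p i (suc l) y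
  closePair {i} {l} yi⊥p pending with pending (y i) yi⊥p
  ... | c , cs , d , d⊥p , p∣S =
    c [ i ]≔ d , unitWeights-[]≔ i cs d⊥p , subst (p ∣_) (sym (weightedSum-[]≔-head i l c d y)) p∣S

  pairUp : ∀ i l → ZeroSumFor (exactPowerParity p 0 y i l) i l
  pairUp i zero    = (λ _ → 1) , (λ _ → 1-coprimeTo p) , (_ ∣0)
  pairUp i (suc l) = extend (exactPower? p 0 (y i)) (pairUp (suc i) l)
    where
      extend : ∀ {b} (e : Dec (ExactPower p 0 (y i))) → ZeroSumFor b (suc i) l → ZeroSumFor (does e xor b) i (suc l)
      extend         (no ¬e) = skipMultiple {l = l} (¬exactPower₀⇒∣ p (y i) ¬e)
      extend {false} (yes e) = openPair {l = l} (¬∣⇒coprime pp (exactPower₀⇒¬∣ e))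
      extend {true}  (yes e) = closePair {l = l} (¬∣⇒coprime pp (exactPower₀⇒¬∣ e))

  evenPairUp : ∀ i l → exactPowerParity p 0 y i l ≡ false → UnitZeroSum p i l y
  evenPairUp i l even = subst (λ b → ZeroSumFor b i l) even (pairUp i l)

balanced⇒unitZeroSum : ∀ ps → All Prime ps → ∀ i l y → Balanced (product ps) i l y → UnitZeroSum (product ps) i l y
balanced⇒unitZeroSum []       _               i l y _   = (λ _ → 1) , (λ _ → 1-coprimeTo 1) , 1∣ _
balanced⇒unitZeroSum (p ∷ qs) (pp ∷ qsPrime) i l y bal
  with p ∣? product qs | onRange-or-counterexample (λ t → p ∣? y t) i l
... | no p∤m | _ =
  unitZeroSum-crt {i = i} {l} {y} (Coprimality.sym (¬∣⇒coprime pp p∤m))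
    (PairUp.evenPairUp pp y i l (bal p 0 pp (*-monoʳ-∣ p (1∣ _))))
    (balanced⇒unitZeroSum qs qsPrime i l y (balanced-∣ {i = i} {l} {y} (n∣m*n p) bal))
  where
    instance
      p≢0 : NonZero p
      p≢0 = prime⇒nonZero pp
      m≢0 : NonZero (product qs)
      m≢0 = productOfPrimes≢0 qsPrime
... | yes p∣m | inj₁ p∣y =
  unitZeroSum-scale {i = i} {l} p∣m y≡pz (balanced⇒unitZeroSum qs qsPrime i l (λ t → y t / p) (balanced-divide {i = i} {l} pp y≡pz bal))
  where
    instance
      p≢0 : NonZero p
      p≢0 = prime⇒nonZero pp
    y≡pz : OnRange i l (λ t → y t ≡ p * (y t / p))
    y≡pz t i≤t t<i+l = sym (m*[n/m]≡n (p∣y t i≤t t<i+l))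
... | yes p∣m | inj₂ (s , i≤s , s<i+l , p∤ys) =
  unitZeroSum-refine {i = i} {l} {y} s ⦃ prime⇒nonZero pp ⦄ p∣m i≤s s<i+l (¬∣⇒coprime pp p∤ys)
    (balanced⇒unitZeroSum qs qsPrime i l y (balanced-∣ {i = i} {l} {y} (n∣m*n p) bal))

-- Every sequence of length 2^Ω has a balanced segment

raiseAt : ℕ → ℕ × ℕ → ℕ × ℕ
raiseAt p (q , v) with q ≟ p
... | yes _ = q , suc v
... | no  _ = q , v

raiseAt-same : ∀ p v → raiseAt p (p , v) ≡ (p , suc v)
raiseAt-same p v with p ≟ p
... | yes _   = refl
... | no  p≢p = ⊥-elim (p≢p refl)

raiseAt-other : ∀ {p q} v → q ≢ p → raiseAt p (q , v) ≡ (q , v)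
raiseAt-other {p} {q} v q≢p with q ≟ p
... | yes q≡p = ⊥-elim (q≢p q≡p)
... | no  _   = refl

-- An entry (q , v) stands for the prime power q ^ (1 + v).
primePowerDivisors : List ℕ → List (ℕ × ℕ)
primePowerDivisors []       = []
primePowerDivisors (p ∷ qs) = (p , 0) ∷ map (raiseAt p) (primePowerDivisors qs)

length-primePowerDivisors : ∀ ps → length (primePowerDivisors ps) ≡ length ps
length-primePowerDivisors []       = refl
length-primePowerDivisors (p ∷ qs) = cong suc (trans (length-map (raiseAt p) (primePowerDivisors qs)) (length-primePowerDivisors qs))

∈-primePowerDivisors : ∀ ps → All Prime ps → ∀ {q} v → Prime q → q ^ suc v ∣ product ps →
                       (q , v) ∈ primePowerDivisors ps
∈-primePowerDivisors []       _             v pq q^v+1∣1 =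
  ⊥-elim (prime≢1 pq (∣1⇒≡1 (∣-trans (m∣m*n (_ ^ v)) q^v+1∣1)))
∈-primePowerDivisors (p ∷ qs) (pp ∷ qsPrime) {q} v pq q^v+1∣n with q ≟ p
∈-primePowerDivisors (p ∷ qs) (pp ∷ qsPrime) zero    pq _ | yes refl = here refl
∈-primePowerDivisors (p ∷ qs) (pp ∷ qsPrime) (suc v) pq p^v+2∣n | yes refl =
  there (subst (_∈ _) (raiseAt-same p v)
    (∈-map⁺ (raiseAt p) (∈-primePowerDivisors qs qsPrime v pp (*-cancelˡ-∣ p ⦃ prime⇒nonZero pp ⦄ p^v+2∣n))))
... | no q≢p =
  there (subst (_∈ _) (raiseAt-other v q≢p)
    (∈-map⁺ (raiseAt p) (∈-primePowerDivisors qs qsPrime v pq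
      (coprime-divisor (distinctPrimes⇒coprime^ (suc v) pp pq q≢p) q^v+1∣n))))

bitOf : Bool → Fin 2
bitOf = Inverse.from 2↔Bool

bitOf-injective : ∀ {a b} → bitOf a ≡ bitOf b → a ≡ b
bitOf-injective {a} {b} e = begin
  a                              ≡⟨ Inverse.strictlyInverseˡ 2↔Bool a ⟨
  Inverse.to 2↔Bool (bitOf a)    ≡⟨ cong (Inverse.to 2↔Bool) e ⟩
  Inverse.to 2↔Bool (bitOf b)    ≡⟨ Inverse.strictlyInverseˡ 2↔Bool b ⟩
  b                              ∎
  where open ≡-Reasoning

prefixCode : (L : List (ℕ × ℕ)) → (ℕ → ℕ) → ℕ → Fin (2 ^ length L)
prefixCode L y j = funToFin λ k → bitOf (uncurry (λ q v → exactPowerParity q v y 0 j) (lookup L k))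

prefixCode-≡ : ∀ L y {a b} → prefixCode L y a ≡ prefixCode L y b →
               ∀ {q v} → (q , v) ∈ L → exactPowerParity q v y 0 a ≡ exactPowerParity q v y 0 b
prefixCode-≡ L y {a} {b} e {q} {v} qv∈L = subst (λ (qv : ℕ × ℕ) → P qv a ≡ P qv b) (sym (lookup-index qv∈L))
  (bitOf-injective (begin
    bitOf (P (lookup L k) a)                      ≡⟨ finToFun-funToFin (λ k → bitOf (P (lookup L k) a)) k ⟨
    finToFun (prefixCode L y a) k                 ≡⟨ cong (λ c → finToFun c k) e ⟩
    finToFun (prefixCode L y b) k                 ≡⟨ finToFun-funToFin (λ k → bitOf (P (lookup L k) b)) k ⟩
    bitOf (P (lookup L k) b)                      ∎))
  where
    open ≡-Reasoning
    k : Fin (length L)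
    k = index qv∈L
    P : ℕ × ℕ → ℕ → Bool
    P (q , v) j = exactPowerParity q v y 0 j

balancedSegment : ∀ ps → All Prime ps → ∀ y →
                  Σ ℕ λ i → Σ ℕ λ l → 1 ≤ l × i + l ≤ 2 ^ length ps × Balanced (product ps) i l y
balancedSegment ps psPrime y with pigeonhole codes<prefixes (λ j → prefixCode L y (toℕ j))
  where
    L : List (ℕ × ℕ)
    L = primePowerDivisors ps
    codes<prefixes : 2 ^ length L < suc (2 ^ length ps)
    codes<prefixes = s≤s (≤-reflexive (cong (2 ^_) (length-primePowerDivisors ps)))
... | a , b , a<b , same = toℕ a , toℕ b ∸ toℕ a , m<n⇒0<n∸m a<b , subst (_≤ 2 ^ length ps) (sym a+l≡b) (s≤s⁻¹ (toℕ<n b)) , balanced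
  where
    a+l≡b : toℕ a + (toℕ b ∸ toℕ a) ≡ toℕ b
    a+l≡b = m+[n∸m]≡n (<⇒≤ a<b)
    balanced : Balanced (product ps) (toℕ a) (toℕ b ∸ toℕ a) y
    balanced q v pq q^v+1∣n = parity-segment _ (toℕ a) _
      (trans (prefixCode-≡ (primePowerDivisors ps) y {toℕ a} {toℕ b} same (∈-primePowerDivisors ps psPrime v pq q^v+1∣n))
             (cong (exactPowerParity q v y 0) (sym a+l≡b)))

finWeights : ∀ n .{{_ : NonZero n}} {i l y} → UnitZeroSum n i l y →
             Σ (ℕ → Fin n) λ a → (∀ t → Unit n (a t)) × n ∣ sumFromTo i l (λ t → toℕ (a t) * y t)
finWeights n {i} {l} {y} (c , cs , n∣S) =
  a , (λ t → coprime-%-cong (a≡c t) (cs t)) , ∣-weightedSum-%-cong i l n y a≡c n∣S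
  where
    a : ℕ → Fin n
    a t = fromℕ< (m%n<n (c t) n)
    a≡c : ∀ t → toℕ (a t) % n ≡ c t % n
    a≡c t = trans (cong (_% n) (toℕ-fromℕ< (m%n<n (c t) n))) (m%n%n≡m%n (c t) n)

everySequenceHasZeroSum : ∀ ps → All Prime ps → (x : Fin (2 ^ length ps) → Fin (product ps)) →
                          HasUnitWeightedConsecutiveZeroSum (product ps) (2 ^ length ps) x
everySequenceHasZeroSum ps psPrime x with balancedSegment ps psPrime (at x)
... | i , l , 1≤l , i+l≤c , bal = i , l , 1≤l , i+l≤c ,
  finWeights (product ps) ⦃ productOfPrimes≢0 psPrime ⦄ {i} {l} (balanced⇒unitZeroSum ps psPrime i l (at x) bal)

-- A sequence of length 2^Ω - 1 without zero sums

witnessLength : List ℕ → ℕ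
witnessLength qs = pred (2 ^ length qs)

2^length≡1+witnessLength : ∀ qs → 2 ^ length qs ≡ suc (witnessLength qs)
2^length≡1+witnessLength qs = sym (suc-pred (2 ^ length qs) ⦃ m^n≢0 2 (length qs) ⦄)

witness : List ℕ → ℕ → ℕ
witness []       t = 0
witness (p ∷ qs) t with <-cmp t (witnessLength qs)
... | tri< _ _ _ = p * witness qs t
... | tri≈ _ _ _ = 1
... | tri> _ _ _ = p * witness qs (t ∸ suc (witnessLength qs))

module _ (p : ℕ) (qs : List ℕ) where
  private
    L : ℕ
    L = witnessLength qs

  witness-left : ∀ {t} → t < L → witness (p ∷ qs) t ≡ p * witness qs t
  witness-left {t} t<L with <-cmp t L
  ... | tri< _ _   _  = refl
  ... | tri≈ t≮L _ _  = ⊥-elim (t≮L t<L)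
  ... | tri> t≮L _ _  = ⊥-elim (t≮L t<L)

  witness-centre : witness (p ∷ qs) L ≡ 1
  witness-centre with <-cmp L L
  ... | tri< L<L _ _ = ⊥-elim (<-irrefl refl L<L)
  ... | tri≈ _ _ _   = refl
  ... | tri> _ _ L>L = ⊥-elim (<-irrefl refl L>L)

  witness-right : ∀ k → witness (p ∷ qs) (suc L + k) ≡ p * witness qs k
  witness-right k with <-cmp (suc L + k) L
  ... | tri< L+k<L _ _ = ⊥-elim (<-asym L+k<L (m≤m+n (suc L) k))
  ... | tri≈ _ L+k≡L _ = ⊥-elim (<-irrefl (sym L+k≡L) (m≤m+n (suc L) k))
  ... | tri> _ _ _     = cong (λ j → p * witness qs j) (m+n∸m≡n (suc L) k)

  p∣witness-offCentre : ∀ {t} → t ≢ L → p ∣ witness (p ∷ qs) t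
  p∣witness-offCentre {t} t≢L with <-cmp t L
  ... | tri< _ _ _ = m∣m*n _
  ... | tri≈ _ t≡L _ = ⊥-elim (t≢L t≡L)
  ... | tri> _ _ _ = m∣m*n _

witness<product : ∀ ps → All Prime ps → ∀ t → witness ps t < product ps
witness<product []       _               t = s≤s z≤n
witness<product (p ∷ qs) (pp ∷ qsPrime) t with <-cmp t (witnessLength qs)
... | tri< _ _ _ = *-monoʳ-< p ⦃ prime⇒nonZero pp ⦄ (witness<product qs qsPrime t)
... | tri≈ _ _ _ = ≤-trans (nonTrivial⇒n>1 p ⦃ prime⇒nonTrivial pp ⦄) (m≤m*n p (product qs) ⦃ productOfPrimes≢0 qsPrime ⦄)
... | tri> _ _ _ = *-monoʳ-< p ⦃ prime⇒nonZero pp ⦄ (witness<product qs qsPrime _)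

witness-noZeroSum : ∀ ps → All Prime ps → ∀ i l → 1 ≤ l → i + l < 2 ^ length ps →
                    ¬ UnitZeroSum (product ps) i l (witness ps)
witness-noZeroSum []       _               i l 1≤l i+l<1 _ = <⇒≱ i+l<1 (≤-trans 1≤l (m≤n+m l i))
witness-noZeroSum (p ∷ qs) (pp ∷ qsPrime) i l 1≤l i+l<2K (a , as , pm∣S) = locate (i + l ≤? L) (suc L ≤? i)
  where
    instance
      p≢0 : NonZero p
      p≢0 = prime⇒nonZero pp
    L S : ℕ
    L = witnessLength qs
    S = weightedSum i l a (witness (p ∷ qs))

    descend : ∀ {j} b → UnitWeights (p * product qs) b → S ≡ p * weightedSum j l b (witness qs) →
              UnitZeroSum (product qs) j l (witness qs)
    descend b bs S≡ = b , (λ t → coprime-∣ʳ (bs t) (n∣m*n p)) , *-cancelˡ-∣ p (subst (p * product qs ∣_) S≡ pm∣S)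

    inLeftHalf : i + l ≤ L → ⊥
    inLeftHalf i+l≤L = witness-noZeroSum qs qsPrime i l 1≤l (subst (i + l <_) (sym (2^length≡1+witnessLength qs)) (s≤s i+l≤L)) (descend a as S≡)
      where
        S≡ : S ≡ p * weightedSum i l a (witness qs)
        S≡ = trans (sumFromTo-cong i l λ t _ t<i+l → cong (a t *_) (witness-left p qs (<-≤-trans t<i+l i+l≤L)))
                   (weightedSum-* i l a p (witness qs))

    inRightHalf : suc L ≤ i → ⊥
    inRightHalf 1+L≤i = witness-noZeroSum qs qsPrime j l 1≤l (subst (j + l <_) (sym (2^length≡1+witnessLength qs)) j+l<1+L) (descend a′ (λ t → as _) S≡)
      where
        j : ℕ
        j = i ∸ suc L
        a′ : ℕ → ℕ
        a′ t = a (suc L + t)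
        1+L+j≡i : suc L + j ≡ i
        1+L+j≡i = m+[n∸m]≡n 1+L≤i
        j+l<1+L : j + l < suc L
        j+l<1+L = +-cancelˡ-< (suc L) (j + l) (suc L) (begin-strict
          suc L + (j + l)       ≡⟨ +-assoc (suc L) j l ⟨
          suc L + j + l         ≡⟨ cong (_+ l) 1+L+j≡i ⟩
          i + l                 <⟨ i+l<2K ⟩
          2 ^ length (p ∷ qs)   ≡⟨ cong (λ K → K + (K + 0)) (2^length≡1+witnessLength qs) ⟩
          suc L + (suc L + 0)   ≡⟨ cong (suc L +_) (+-identityʳ (suc L)) ⟩
          suc L + suc L         ∎)
          where open ≤-Reasoning
        S≡ : S ≡ p * weightedSum j l a′ (witness qs)
        S≡ = begin
          S                                                   ≡⟨ cong (λ k → weightedSum k l a (witness (p ∷ qs))) 1+L+j≡i ⟨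
          weightedSum (suc L + j) l a (witness (p ∷ qs))      ≡⟨ sumFromTo-shift (suc L) j l _ ⟩
          weightedSum j l a′ (λ t → witness (p ∷ qs) (suc L + t)) ≡⟨ sumFromTo-cong j l (λ t _ _ → cong (a′ t *_) (witness-right p qs t)) ⟩
          weightedSum j l a′ (λ t → p * witness qs t)         ≡⟨ weightedSum-* j l a′ p (witness qs) ⟩
          p * weightedSum j l a′ (witness qs)                 ∎
          where open ≡-Reasoning

    throughCentre : i ≤ L → L < i + l → ⊥
    throughCentre i≤L L<i+l = coprime⇒¬∣ pp (as L) (m∣m*n (product qs))
      (subst (p ∣_) (trans (cong (a L *_) (witness-centre p qs)) (*-identityʳ (a L)))
        (∣-sumFromTo-single i l L i≤L L<i+l (λ t t≢L → ∣n⇒∣m*n (a t) (p∣witness-offCentre p qs t≢L))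
          (∣-trans (m∣m*n (product qs)) pm∣S)))

    locate : Dec (i + l ≤ L) → Dec (suc L ≤ i) → ⊥
    locate (yes i+l≤L) _            = inLeftHalf i+l≤L
    locate (no _)      (yes 1+L≤i)  = inRightHalf 1+L≤i
    locate (no i+l≰L)  (no 1+L≰i)   = throughCentre (s≤s⁻¹ (≰⇒> 1+L≰i)) (≰⇒> i+l≰L)

at-fromℕ< : ∀ {k n} (x : Fin k → Fin n) t (t<k : t < k) → at x t ≡ toℕ (x (fromℕ< t<k))
at-fromℕ< {suc k} x zero    _         = refl
at-fromℕ< {suc k} x (suc t) (s≤s t<k) = at-fromℕ< (λ j → x (Fin.suc j)) t t<k

shorterSequenceWithoutZeroSum : ∀ ps → All Prime ps → ∀ k → k < 2 ^ length ps →
  Σ (Fin k → Fin (product ps)) λ x → ¬ HasUnitWeightedConsecutiveZeroSum (product ps) k x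
shorterSequenceWithoutZeroSum ps psPrime k k<c = x , λ (i , l , 1≤l , i+l≤k , w , ws , n∣S) →
  witness-noZeroSum ps psPrime i l 1≤l (≤-<-trans i+l≤k k<c)
    ((λ t → toℕ (w t)) , ws , subst (product ps ∣_)
      (sumFromTo-cong i l λ t _ t<i+l → cong (toℕ (w t) *_) (at-witness t (<-≤-trans t<i+l i+l≤k))) n∣S)
  where
    x : Fin k → Fin (product ps)
    x j = fromℕ< (witness<product ps psPrime (toℕ j))
    at-witness : ∀ t → t < k → at x t ≡ witness ps t
    at-witness t t<k = trans (at-fromℕ< x t t<k)
      (trans (toℕ-fromℕ< (witness<product ps psPrime _)) (cong (witness ps) (toℕ-fromℕ< t<k)))

mainTheorem1 : (n : ℕ) → 1 ≤ n → (ps : List ℕ) → IsPrimeFactorisation n ps →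
    IsCUn n (2 ^ length ps)
mainTheorem1 .(product ps) _ ps (psPrime , refl) =
  m^n>0 2 (length ps) ,
  everySequenceHasZeroSum ps psPrime ,
  λ k _ k<c → shorterSequenceWithoutZeroSum ps psPrime k k<c
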